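{- There is a universal constant $C>0$ such that for any two graphs $G$ and $H$ whose numbers of vertices are powers of $2$, $$\mathrm{opt}(R[G\cdot H])\leq \chi(G)\big(\mathrm{opt}(R[H])+C|V(G)|\big).$$
   Context: For a graph $G$ with $|V(G)|=2^k$ whose vertices are assigned distinct strings $\mathrm{enc}(u)\in\{0,1\}^k$, $R[G]$ is the pair of sample sets $P=\{\mathrm{enc}(u)1\mathrm{enc}(u)^R: u\in V(G)\}$ (positive) and $N=\{\mathrm{enc}(u)1\mathrm{enc}(v)^R: uv\in E(G)\}$ (negative), where $x^R$ is the reversal of $x$. The lexicographic product $G\cdot H$ has vertex set $V(G)\times V(H)$ and an edge between $(u,a)$ and $(v,b)$ iff $uv\in E(G)$, or $u=v$ and $ab\in E(H)$; its vertices are encoded as $\mathrm{enc}((u,a))=\mathrm{enc}(u)\mathrm{enc}(a)$. A DFA over $\{0,1\}$ is canonical if its state diagram has exactly $\ell$ layers for some $\ell$, every path from the initial state $q_0$ to any sink has length exactly $\ell$, and all accepting states lie in the last layer. $\mathrm{opt}(R[G])$ denotes the minimum number of states of a canonical DFA that accepts all strings in $P$ and rejects all strings in $N$. $\chi(G)$ is the chromatic number. -}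

module Defs where

open import Data.Nat using (ℕ; zero; suc; _+_; _*_; _^_; _≤_)
open import Data.Bool using (Bool; true; false)
open import Data.Fin using (Fin)
open import Data.Maybe using (Maybe; just; nothing)
open import Data.Vec as Vec using (Vec; take; drop)
open import Data.List using (List; []; _∷_; _++_; reverse; length)
open import Data.Product using (Σ; ∃; _×_; _,_; proj₁; proj₂)
open import Data.Sum using (_⊎_; inj₁; inj₂)
open import Data.Empty using (⊥)
open import Relation.Nullary using (¬_)
open import Relation.Binary.PropositionalEquality using (_≡_; _≢_; refl; sym)

-- The vertex set is {0,1}^k itself and the
-- encoding enc is the identity (any graph with |V| = 2^k and a
-- bijective encoding into {0,1}^k is of this form up to renaming).

Word : ℕ → Set
Word k = Vec Bool k

record Graph (k : ℕ) : Set₁ where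
  field
    Adj   : Word k → Word k → Set
    adj-sym : ∀ {u v} → Adj u v → Adj v u
    adj-irrefl : ∀ {u} → ¬ Adj u u

open Graph public

∣V∣ : ∀ {k} → Graph k → ℕ
∣V∣ {k} _ = 2 ^ k

-- Lexicographic product G · H, with enc((u,a)) = enc(u) enc(a).
_·_ : ∀ {k m} → Graph k → Graph m → Graph (k + m)
_·_ {k} {m} G H = record
  { Adj = λ x y → Adj G (take k x) (take k y)
                   ⊎ (take k x ≡ take k y × Adj H (drop k x) (drop k y))
  ; adj-sym = λ { (inj₁ e) → inj₁ (adj-sym G e)
            ; (inj₂ (eq , e)) → inj₂ (sym eq , adj-sym H e) }
  ; adj-irrefl = λ { (inj₁ e) → adj-irrefl G e ; (inj₂ (_ , e)) → adj-irrefl H e }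
  }

ProperColouring : ∀ {k} → Graph k → (c : ℕ) → (Word k → Fin c) → Set
ProperColouring G c col = ∀ u v → Adj G u v → col u ≢ col v

Colourable : ∀ {k} → Graph k → ℕ → Set
Colourable {k} G c = Σ (Word k → Fin c) (ProperColouring G c)

IsChromaticNumber : ∀ {k} → Graph k → ℕ → Set
IsChromaticNumber G n = Colourable G n × (∀ m → Colourable G m → n ≤ m)

String : Set
String = List Bool

sampleWord : ∀ {k} → Word k → Word k → String
sampleWord u v = Vec.toList u ++ (true ∷ reverse (Vec.toList v))

record Sample : Set₁ where
  field
    Pos : String → Set
    Neg : String → Set

open Sample public

R[_] : ∀ {k} → Graph k → Sample
R[_] {k} G = record
  { Pos = λ w → Σ (Word k) λ u → w ≡ sampleWord u u
  ; Neg = λ w → Σ (Word k) λ u → Σ (Word k) λ v → Adj G u v × w ≡ sampleWord u v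
  }

record DFA (n : ℕ) : Set where
  field
    δ   : Fin n → Bool → Maybe (Fin n)
    q₀  : Fin n
    acc : Fin n → Bool

open DFA public

run : ∀ {n} → DFA n → Fin n → String → Maybe (Fin n)
run A q []      = just q
run A q (b ∷ w) with δ A q b
... | just q' = run A q' w
... | nothing = nothing

Accepts : ∀ {n} → DFA n → String → Set
Accepts A w = Σ _ λ q → run A (q₀ A) w ≡ just q × acc A q ≡ true

IsSink : ∀ {n} → DFA n → Fin n → Set
IsSink A q = δ A q false ≡ nothing × δ A q true ≡ nothing

record Canonical {n} (A : DFA n) (ℓ : ℕ) : Set where
  field
    layer       : Fin n → ℕ
    layer-bound : ∀ q → layer q ≤ ℓ
    layer-q₀    : layer (q₀ A) ≡ 0
    layer-step  : ∀ q b q' → δ A q b ≡ just q' → layer q' ≡ suc (layer q)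
    sink-paths  : ∀ w q → run A (q₀ A) w ≡ just q → IsSink A q → length w ≡ ℓ
    acc-last    : ∀ q → acc A q ≡ true → layer q ≡ ℓ

Consistent : ∀ {n} → DFA n → Sample → Set
Consistent A S = (∀ w → Pos S w → Accepts A w) × (∀ w → Neg S w → ¬ Accepts A w)

Solves : Sample → ℕ → Set
Solves S n = Σ (DFA n) λ A → Σ ℕ (Canonical A) × Consistent A S

IsOpt : Sample → ℕ → Set
IsOpt S n = Solves S n × (∀ m → Solves S m → n ≤ m)

-- Fix a proper colouring col of G with χ colours and a canonical DFA A_H for R[H]. A sample word
-- of G · H reads u (a 1 bᴿ) vᴿ, where u, v ∈ {0,1}^k code vertices of G and a, b ∈ {0,1}^m code
-- vertices of H. The automaton for R[G · H] reads u along a binary tree of depth k, then runs the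
-- copy of A_H labelled col(u) on a 1 bᴿ, and finally reads vᴿ along a binary tree of depth k that
-- remembers col(u) and whether A_H accepted; it accepts iff A_H accepted and col(v) = col(u).
-- Positive samples (u = v, a = b) pass. A negative sample either joins two vertices of G, which have
-- different colours, or has u = v and ab ∈ E(H), so A_H rejects a 1 bᴿ. The χ copies of A_H cost
-- χ·opt(R[H]) states and the 2χ + 1 trees fewer than (2χ + 1)·2^(k+1) ≤ 6χ·|V(G)|.

module Submission where

open import Defs
open import Data.Nat using (ℕ; NonZero; zero; suc; _+_; _*_; _^_; _≤_; _<_; _>_; s≤s⁻¹; z<s)
open import Data.Nat.Properties
open import Data.Nat.Solver using (module +-*-Solver)
open import Data.Bool using (Bool; true; false; _∧_)
open import Data.Fin as Fin using (Fin)
open import Data.Fin.Properties using (1↔⊤; 2↔Bool; +↔⊎; *↔×; nonZeroIndex)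
open import Data.Maybe as Maybe using (Maybe; just; nothing; _>>=_)
open import Data.Maybe.Properties using (just-injective)
open import Data.Vec as Vec using ([]; _∷_)
open import Data.Vec.Bounded as Vec≤ using (Vec≤; isBounded)
open import Data.List using ([]; _∷_; _++_; length; reverse; _ʳ++_)
import Data.List.Properties as LP
import Data.Vec.Properties as VP
open import Data.Product using (Σ; _×_; _,_; proj₁; proj₂)
open import Data.Sum using (_⊎_; inj₁; inj₂)
open import Data.Unit using (⊤; tt)
open import Function using (_∘_; _↪_; mk↪; RightInverse)
open import Function.Properties.Inverse using (↔⇒↪)
open import Function.Construct.Composition using (_↪-∘_)
open import Function.Construct.Identity using (↪-id)
open import Function.Construct.Symmetry using (↔-sym)
open import Data.Product.Function.NonDependent.Propositional using (_×-↪_)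
open import Data.Sum.Function.Propositional using (_⊎-↪_)
open import Relation.Nullary using (¬_; Dec; yes; no; contradiction)
open import Relation.Nullary.Decidable using (does; dec-true)
open import Relation.Binary.PropositionalEquality

map-just⁻¹ : ∀ {A B : Set} {f : A → B} mx {y} → Maybe.map f mx ≡ just y →
             Σ A λ x → mx ≡ just x × f x ≡ y
map-just⁻¹ (just x) refl = x , refl , refl

map-nothing⁻¹ : ∀ {A B : Set} {f : A → B} mx → Maybe.map f mx ≡ nothing → mx ≡ nothing
map-nothing⁻¹ nothing refl = refl

does-true⁻¹ : ∀ {A : Set} (a? : Dec A) → does a? ≡ true → A
does-true⁻¹ (yes a) _ = a

∧-true⁻¹ : ∀ x y → x ∧ y ≡ true → x ≡ true × y ≡ true
∧-true⁻¹ true true _ = refl , refl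

-- Runs of partial automata

runWith : {S : Set} → (S → Bool → Maybe S) → S → String → Maybe S
runWith δ s []      = just s
runWith δ s (b ∷ w) = δ s b >>= λ s′ → runWith δ s′ w

module _ {S : Set} (δ : S → Bool → Maybe S) where

  runWith-++ : ∀ s xs ys →
               runWith δ s (xs ++ ys) ≡ (runWith δ s xs >>= λ s′ → runWith δ s′ ys)
  runWith-++ s []       ys = refl
  runWith-++ s (b ∷ xs) ys with δ s b
  ... | just s′ = runWith-++ s′ xs ys
  ... | nothing = refl

  runWith-step : ∀ s b {s′} w → δ s b ≡ just s′ → runWith δ s (b ∷ w) ≡ runWith δ s′ w
  runWith-step s b w eq = cong (_>>= λ s′ → runWith δ s′ w) eq

  runWith-++-just : ∀ {s s′} xs ys → runWith δ s xs ≡ just s′ →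
                    runWith δ s (xs ++ ys) ≡ runWith δ s′ ys
  runWith-++-just {s} xs ys eq = trans (runWith-++ s xs ys) (cong (_>>= λ s′ → runWith δ s′ ys) eq)

  runWith-++-nothing : ∀ {s} xs ys → runWith δ s xs ≡ nothing → runWith δ s (xs ++ ys) ≡ nothing
  runWith-++-nothing {s} xs ys eq = trans (runWith-++ s xs ys) (cong (_>>= λ s′ → runWith δ s′ ys) eq)

  runWith-invariant : (P : S → Set) → (∀ s b s′ → P s → δ s b ≡ just s′ → P s′) →
                      ∀ {s s′} w → P s → runWith δ s w ≡ just s′ → P s′
  runWith-invariant P preserved []      p refl = p
  runWith-invariant P preserved {s} (b ∷ w) p eq with δ s b in δsb
  ... | just s″ = runWith-invariant P preserved w (preserved s b s″ p δsb) eq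

  runWith-layer : (L : S → ℕ) → (∀ s b s′ → δ s b ≡ just s′ → L s′ ≡ suc (L s)) →
                  ∀ {s s′} w → runWith δ s w ≡ just s′ → L s′ ≡ L s + length w
  runWith-layer L increments {s} []      refl = sym (+-identityʳ (L s))
  runWith-layer L increments {s} (b ∷ w) eq with δ s b in δsb
  ... | just s″ = begin
    L _                  ≡⟨ runWith-layer L increments w eq ⟩
    L s″ + length w      ≡⟨ cong (_+ length w) (increments s b s″ δsb) ⟩
    suc (L s) + length w ≡⟨ +-suc (L s) (length w) ⟨
    L s + length (b ∷ w) ∎
    where open ≡-Reasoning

run≡runWith : ∀ {n} (A : DFA n) q w → run A q w ≡ runWith (δ A) q w
run≡runWith A q []      = refl
run≡runWith A q (b ∷ w) with δ A q b
... | just q′ = run≡runWith A q′ w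
... | nothing = refl

run⇒runWith : ∀ {n} (A : DFA n) {q r} w → run A q w ≡ r → runWith (δ A) q w ≡ r
run⇒runWith A w eq = trans (sym (run≡runWith A _ w)) eq

module CanonicalDFA {n} {A : DFA n} {ℓ} (C : Canonical A ℓ) where
  open Canonical C

  layer-run : ∀ {q} w → run A (q₀ A) w ≡ just q → layer q ≡ length w
  layer-run w eq = begin
    layer _                  ≡⟨ runWith-layer (δ A) layer layer-step w (run⇒runWith A w eq) ⟩
    layer (q₀ A) + length w  ≡⟨ cong (_+ length w) layer-q₀ ⟩
    length w                 ∎
    where open ≡-Reasoning

  last-layer-stuck : ∀ {q} b → layer q ≡ ℓ → δ A q b ≡ nothing
  last-layer-stuck {q} b eq with δ A q b in δqb
  ... | nothing = refl
  ... | just q′ =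
    contradiction (subst (_≤ ℓ) (trans (layer-step q b q′ δqb) (cong suc eq)) (layer-bound q′)) 1+n≰n

  accepted-length : ∀ w → Accepts A w → length w ≡ ℓ
  accepted-length w (q , eq , acc) = trans (sym (layer-run w eq)) (acc-last q acc)

record Automaton (S : Set) : Set where
  field
    step  : S → Bool → Maybe S
    start : S
    final : S → Bool

module _ {S : Set} (M : Automaton S) where
  open Automaton M

  AcceptsM : String → Set
  AcceptsM w = Σ S λ s → runWith step start w ≡ just s × final s ≡ true

  ConsistentM : Sample → Set
  ConsistentM smp = (∀ w → Pos smp w → AcceptsM w) × (∀ w → Neg smp w → ¬ AcceptsM w)

  record IsCanonical (ℓ : ℕ) : Set where
    field
      layer       : S → ℕ
      layer-bound : ∀ s → layer s ≤ ℓ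
      layer-start : layer start ≡ 0
      layer-step  : ∀ s b s′ → step s b ≡ just s′ → layer s′ ≡ suc (layer s)
      sink-paths  : ∀ w s → runWith step start w ≡ just s →
                    (∀ b → step s b ≡ nothing) → length w ≡ ℓ
      final-last  : ∀ s → final s ≡ true → layer s ≡ ℓ

module _ {S : Set} {n : ℕ} (M : Automaton S) (e : S ↪ Fin n) where
  open Automaton M
  open RightInverse e using (to; from; strictlyInverseʳ)

  toDFA : DFA n
  toDFA = record { δ = λ i b → Maybe.map to (step (from i) b) ; q₀ = to start ; acc = final ∘ from }

  δ-toDFA : ∀ s b → δ toDFA (to s) b ≡ Maybe.map to (step s b)
  δ-toDFA s b = cong (λ s′ → Maybe.map to (step s′ b)) (strictlyInverseʳ s)

  run-toDFA : ∀ s w → run toDFA (to s) w ≡ Maybe.map to (runWith step s w)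
  run-toDFA s []      = refl
  run-toDFA s (b ∷ w) rewrite δ-toDFA s b with step s b
  ... | just s′ = run-toDFA s′ w
  ... | nothing = refl

  private
    reached : ∀ w {i} → run toDFA (q₀ toDFA) w ≡ just i →
              Σ S λ s → runWith step start w ≡ just s × to s ≡ i
    reached w eq = map-just⁻¹ (runWith step start w) (trans (sym (run-toDFA start w)) eq)

  toDFA-accepts : ∀ w → AcceptsM M w → Accepts toDFA w
  toDFA-accepts w (s , eq , fin) =
    to s , trans (run-toDFA start w) (cong (Maybe.map to) eq) , trans (cong final (strictlyInverseʳ s)) fin

  toDFA-accepts⁻¹ : ∀ w → Accepts toDFA w → AcceptsM M w
  toDFA-accepts⁻¹ w (i , eq , fin) with reached w eq
  ... | s , eq′ , refl = s , eq′ , trans (sym (cong final (strictlyInverseʳ s))) fin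

  toDFA-canonical : ∀ {ℓ} → IsCanonical M ℓ → Canonical toDFA ℓ
  toDFA-canonical {ℓ} C = record
    { layer       = layer ∘ from
    ; layer-bound = layer-bound ∘ from
    ; layer-q₀    = trans (cong layer (strictlyInverseʳ start)) layer-start
    ; layer-step  = layer-step′
    ; sink-paths  = sink-paths′
    ; acc-last    = final-last ∘ from
    }
    where
      open IsCanonical C

      layer-step′ : ∀ i b j → δ toDFA i b ≡ just j → layer (from j) ≡ suc (layer (from i))
      layer-step′ i b j δij with map-just⁻¹ (step (from i) b) δij
      ... | s , eq , refl = trans (cong layer (strictlyInverseʳ s)) (layer-step (from i) b s eq)

      sink-paths′ : ∀ w j → run toDFA (q₀ toDFA) w ≡ just j → IsSink toDFA j → length w ≡ ℓ
      sink-paths′ w j eq (stuck₀ , stuck₁) with reached w eq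
      ... | s , eq′ , refl = sink-paths w s eq′ stuck
        where
          stuck : ∀ b → step s b ≡ nothing
          stuck false = map-nothing⁻¹ (step s false) (trans (sym (δ-toDFA s false)) stuck₀)
          stuck true  = map-nothing⁻¹ (step s true) (trans (sym (δ-toDFA s true)) stuck₁)

  toDFA-solves : ∀ {ℓ smp} → IsCanonical M ℓ → ConsistentM M smp → Solves smp n
  toDFA-solves C (positive , negative) =
    toDFA , (_ , toDFA-canonical C) ,
    (λ w → toDFA-accepts w ∘ positive w) , (λ w neg → negative w neg ∘ toDFA-accepts⁻¹ w)

-- Encodings into Fin

module _ {A B : Set} {m n : ℕ} where

  ⊎↪+ : A ↪ Fin m → B ↪ Fin n → (A ⊎ B) ↪ Fin (m + n)
  ⊎↪+ e f = ↔⇒↪ (↔-sym +↔⊎) ↪-∘ (e ⊎-↪ f)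

  ×↪* : A ↪ Fin m → B ↪ Fin n → (A × B) ↪ Fin (m * n)
  ×↪* e f = ↔⇒↪ (↔-sym *↔×) ↪-∘ (e ×-↪ f)

module _ {A : Set} where

  Vec≤-zero↪⊤ : Vec≤ A 0 ↪ ⊤
  Vec≤-zero↪⊤ = mk↪ {to = λ _ → tt} {from = λ _ → Vec≤.[]} λ { {x} refl → empty x }
    where
      empty : (xs : Vec≤ A 0) → Vec≤.[] ≡ xs
      empty (Vec≤._,_ []      _) = refl
      empty xs@(Vec≤._,_ (_ ∷ _) _) with () ← isBounded xs

  Vec≤-uncons↪ : ∀ {n} → Vec≤ A (suc n) ↪ (⊤ ⊎ (A × Vec≤ A n))
  Vec≤-uncons↪ {n} = mk↪ {to = uncons} {from = cons} λ { {xs} refl → cons-uncons xs }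
    where
      uncons : Vec≤ A (suc n) → ⊤ ⊎ (A × Vec≤ A n)
      uncons (Vec≤._,_ []       _) = inj₁ tt
      uncons (Vec≤._,_ (a ∷ as) p) = inj₂ (a , Vec≤._,_ as (s≤s⁻¹ p))

      cons : ⊤ ⊎ (A × Vec≤ A n) → Vec≤ A (suc n)
      cons (inj₁ _)        = Vec≤.[]
      cons (inj₂ (a , as)) = a Vec≤.∷ as

      cons-uncons : ∀ xs → cons (uncons xs) ≡ xs
      cons-uncons (Vec≤._,_ []      _) = refl
      cons-uncons (Vec≤._,_ (_ ∷ _) _) = refl

#bitStrings≤ : ℕ → ℕ
#bitStrings≤ zero    = 1
#bitStrings≤ (suc n) = 1 + 2 * #bitStrings≤ n

bitStrings≤↪Fin : ∀ n → Vec≤ Bool n ↪ Fin (#bitStrings≤ n)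
bitStrings≤↪Fin zero    = ↔⇒↪ (↔-sym 1↔⊤) ↪-∘ Vec≤-zero↪⊤
bitStrings≤↪Fin (suc n) =
  ⊎↪+ (↔⇒↪ (↔-sym 1↔⊤)) (×↪* (↔⇒↪ (↔-sym 2↔Bool)) (bitStrings≤↪Fin n))
    ↪-∘ Vec≤-uncons↪

suc-#bitStrings≤ : ∀ n → suc (#bitStrings≤ n) ≡ 2 ^ suc n
suc-#bitStrings≤ zero    = refl
suc-#bitStrings≤ (suc n) = begin
  suc (suc (2 * #bitStrings≤ n)) ≡⟨ *-distribˡ-+ 2 1 (#bitStrings≤ n) ⟨
  2 * suc (#bitStrings≤ n)       ≡⟨ cong (2 *_) (suc-#bitStrings≤ n) ⟩
  2 * 2 ^ suc n                  ∎
  where open ≡-Reasoning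

module _ {A : Set} {n : ℕ} where

  push : Vec≤ A n → A → Maybe (Vec≤ A n)
  push xs a with Vec≤.length xs <? n
  ... | yes room = just (Vec≤._,_ (a ∷ Vec≤.vec xs) room)
  ... | no  _    = nothing

  push-room : ∀ xs a (room : Vec≤.length xs < n) →
              push xs a ≡ just (Vec≤._,_ (a ∷ Vec≤.vec xs) room)
  push-room xs a room with Vec≤.length xs <? n
  ... | yes _    = refl
  ... | no  full = contradiction room full

  push-just⁻¹ : ∀ xs a {ys} → push xs a ≡ just ys →
                Σ (Vec≤.length xs < n) λ room → ys ≡ Vec≤._,_ (a ∷ Vec≤.vec xs) room
  push-just⁻¹ xs a eq with Vec≤.length xs <? n
  ... | yes room = room , sym (just-injective eq)

  push-nothing⁻¹ : ∀ xs a → push xs a ≡ nothing → Vec≤.length xs ≡ n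
  push-nothing⁻¹ xs a eq with Vec≤.length xs <? n
  ... | no full = ≤-antisym (isBounded xs) (≮⇒≥ full)

  map-push-just⁻¹ : ∀ {B : Set} (g : Vec≤ A n → B) xs a {y} →
                    Maybe.map g (push xs a) ≡ just y →
                    Σ (Vec≤.length xs < n) λ room → y ≡ g (Vec≤._,_ (a ∷ Vec≤.vec xs) room)
  map-push-just⁻¹ g xs a eq with map-just⁻¹ (push xs a) eq
  ... | _ , pushed , refl with push-just⁻¹ xs a pushed
  ...   | room , refl = room , refl

length-toList≤ : ∀ {A : Set} {n} (xs : Vec≤ A n) → length (Vec≤.toList xs) ≡ Vec≤.length xs
length-toList≤ xs = VP.length-toList (Vec≤.vec xs)

word? : ∀ n → String → Maybe (Word n)
word? zero    []      = just []
word? zero    (_ ∷ _) = nothing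
word? (suc n) []      = nothing
word? (suc n) (b ∷ w) = Maybe.map (b ∷_) (word? n w)

word?-toList : ∀ {n} (u : Word n) → word? n (Vec.toList u) ≡ just u
word?-toList []      = refl
word?-toList (b ∷ u) = cong (Maybe.map (b ∷_)) (word?-toList u)

word?-length : ∀ n w {u} → word? n w ≡ just u → length w ≡ n
word?-length zero    []      _  = refl
word?-length (suc n) (b ∷ w) eq with map-just⁻¹ (word? n w) eq
... | _ , eq′ , _ = cong suc (word?-length n w eq′)

word?-nothing : ∀ n w → word? n w ≡ nothing → length w ≢ n
word?-nothing zero    (_ ∷ _) _  ()
word?-nothing (suc n) (b ∷ w) eq len with word? n w in eq′
... | nothing = word?-nothing n w eq′ (suc-injective len)

length-sampleWord : ∀ {m} (a b : Word m) → length (sampleWord a b) ≡ m + suc m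
length-sampleWord {m} a b = begin
  length (sampleWord a b)                                       ≡⟨ LP.length-++ (Vec.toList a) ⟩
  length (Vec.toList a) + suc (length (reverse (Vec.toList b))) ≡⟨ cong₂ (λ i j → i + suc j)
                                                                     (VP.length-toList a) length-reverse-b ⟩
  m + suc m                                                     ∎
  where
    open ≡-Reasoning
    length-reverse-b = trans (LP.length-reverse (Vec.toList b)) (VP.length-toList b)

sampleWord-take-drop : ∀ k {m} (x y : Word (k + m)) →
  sampleWord x y ≡ Vec.toList (Vec.take k x) ++
                   sampleWord (Vec.drop k x) (Vec.drop k y) ++
                   reverse (Vec.toList (Vec.take k y))
sampleWord-take-drop k x y = begin
  Vec.toList x ++ true ∷ reverse (Vec.toList y)
    ≡⟨ cong₂ (λ l r → l ++ true ∷ reverse r) (toList-take-drop x) (toList-take-drop y) ⟩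
  (u ++ a) ++ true ∷ reverse (v ++ b)
    ≡⟨ cong (λ r → (u ++ a) ++ true ∷ r) (LP.reverse-++ v b) ⟩
  (u ++ a) ++ true ∷ (reverse b ++ reverse v)
    ≡⟨ LP.++-assoc u a _ ⟩
  u ++ a ++ (true ∷ reverse b) ++ reverse v
    ≡⟨ cong (u ++_) (LP.++-assoc a (true ∷ reverse b) (reverse v)) ⟨
  u ++ (a ++ true ∷ reverse b) ++ reverse v ∎
  where
    open ≡-Reasoning
    u = Vec.toList (Vec.take k x)
    a = Vec.toList (Vec.drop k x)
    v = Vec.toList (Vec.take k y)
    b = Vec.toList (Vec.drop k y)
    toList-take-drop : ∀ z → Vec.toList z ≡ Vec.toList (Vec.take k z) ++ Vec.toList (Vec.drop k z)
    toList-take-drop z = trans (cong Vec.toList (sym (VP.take++drop≡id k z)))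
                               (VP.toList-++ (Vec.take k z) (Vec.drop k z))

-- The automaton for R[G · H]

module Construction {k χ nH ℓH : ℕ} (col : Word k → Fin χ) (AH : DFA nH) (CH : Canonical AH ℓH)
  where
  open Canonical CH renaming (layer to layerH; layer-step to layerH-step; layer-bound to layerH-bound)
  open CanonicalDFA CH

  State : Set
  State = (Fin χ × Fin nH) ⊎ ((Fin χ × Bool × Vec≤ Bool k) ⊎ Vec≤ Bool k)

  pattern middle c q      = inj₁ (c , q)
  pattern suffix c f bs   = inj₂ (inj₁ (c , f , bs))
  pattern prefix bs       = inj₂ (inj₂ bs)

  -- Buffers hold the bits read so far in reverse order.
  afterPrefix : Vec≤ Bool k → State
  afterPrefix bs with word? k (reverse (Vec≤.toList bs))
  ... | just u  = middle (col u) (q₀ AH)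
  ... | nothing = prefix bs

  step : State → Bool → Maybe State
  step (prefix bs)     b = Maybe.map afterPrefix (push bs b)
  step (middle c q)    b with δ AH q b
  ... | just q′ = just (middle c q′)
  -- A_H getting stuck below its last layer is a rejection; only its last layer leads on.
  ... | nothing with layerH q ≟ ℓH
  ...   | yes _ = Maybe.map (suffix c (acc AH q)) (push Vec≤.[] b)
  ...   | no  _ = nothing
  step (suffix c f bs) b = Maybe.map (suffix c f) (push bs b)

  hasColour : Fin χ → String → Bool
  hasColour c w = Maybe.maybe′ (λ v → does (col v Fin.≟ c)) false (word? k w)

  final : State → Bool
  final (prefix _)      = false
  final (middle c q)    = acc AH q ∧ hasColour c []   -- only possible for k = 0
  final (suffix c f bs) = f ∧ hasColour c (Vec≤.toList bs)

  start : State
  start = afterPrefix Vec≤.[]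

  M : Automaton State
  M = record { step = step ; start = start ; final = final }

  ℓ : ℕ
  ℓ = k + ℓH + k

  layer : State → ℕ
  layer (prefix bs)     = Vec≤.length bs
  layer (middle _ q)    = k + layerH q
  layer (suffix _ _ bs) = k + ℓH + Vec≤.length bs

  full-buffer : ∀ (bs : Vec≤ Bool k) {u} → word? k (reverse (Vec≤.toList bs)) ≡ just u →
                Vec≤.length bs ≡ k
  full-buffer bs eq = begin
    Vec≤.length bs                        ≡⟨ length-toList≤ bs ⟨
    length (Vec≤.toList bs)               ≡⟨ LP.length-reverse (Vec≤.toList bs) ⟨
    length (reverse (Vec≤.toList bs))     ≡⟨ word?-length k _ eq ⟩
    k                                     ∎
    where open ≡-Reasoning

  afterPrefix-partial : ∀ bs → Vec≤.length bs < k → afterPrefix bs ≡ prefix bs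
  afterPrefix-partial bs short with word? k (reverse (Vec≤.toList bs)) in eq
  ... | just _  = contradiction (full-buffer bs eq) (<⇒≢ short)
  ... | nothing = refl

  afterPrefix-complete : ∀ bs u → reverse (Vec≤.toList bs) ≡ Vec.toList u →
                         afterPrefix bs ≡ middle (col u) (q₀ AH)
  afterPrefix-complete bs u eq
    with word? k (reverse (Vec≤.toList bs)) | trans (cong (word? k) eq) (word?-toList u)
  ... | just _ | refl = refl

  layer-afterPrefix : ∀ bs → layer (afterPrefix bs) ≡ Vec≤.length bs
  layer-afterPrefix bs with word? k (reverse (Vec≤.toList bs)) in eq
  ... | just _  = trans (cong (k +_) layer-q₀) (trans (+-identityʳ k) (sym (full-buffer bs eq)))
  ... | nothing = refl

  layer-step : ∀ s b s′ → step s b ≡ just s′ → layer s′ ≡ suc (layer s)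
  layer-step (prefix bs) b _ eq with map-push-just⁻¹ afterPrefix bs b eq
  ... | _ , refl = layer-afterPrefix _
  layer-step (middle c q) b _ eq with δ AH q b in δqb
  ... | just q′ with refl ← eq = trans (cong (k +_) (layerH-step q b q′ δqb)) (+-suc k _)
  ... | nothing with layerH q ≟ ℓH
  ...   | yes top with map-push-just⁻¹ (suffix c (acc AH q)) Vec≤.[] b eq
  ...     | _ , refl = begin
    k + ℓH + 1         ≡⟨ +-suc (k + ℓH) 0 ⟩
    suc (k + ℓH + 0)   ≡⟨ cong suc (+-identityʳ (k + ℓH)) ⟩
    suc (k + ℓH)       ≡⟨ cong (λ i → suc (k + i)) top ⟨
    suc (k + layerH q) ∎
    where open ≡-Reasoning
  layer-step (suffix c f bs) b _ eq with map-push-just⁻¹ (suffix c f) bs b eq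
  ... | _ , refl = +-suc (k + ℓH) _

  layer-bound : ∀ s → layer s ≤ ℓ
  layer-bound (prefix bs)     = ≤-trans (isBounded bs) (≤-trans (m≤m+n k ℓH) (m≤m+n (k + ℓH) k))
  layer-bound (middle _ q)    = ≤-trans (+-monoʳ-≤ k (layerH-bound q)) (m≤m+n (k + ℓH) k)
  layer-bound (suffix _ _ bs) = +-monoʳ-≤ (k + ℓH) (isBounded bs)

  ReachableShape : State → Set
  ReachableShape (prefix bs)    = Vec≤.length bs < k
  ReachableShape (middle _ q)   = Σ String λ w → run AH (q₀ AH) w ≡ just q
  ReachableShape (suffix _ _ _) = ⊤

  afterPrefix-shape : ∀ bs → ReachableShape (afterPrefix bs)
  afterPrefix-shape bs with word? k (reverse (Vec≤.toList bs)) in eq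
  ... | just _  = [] , refl
  ... | nothing = ≤∧≢⇒< (isBounded bs) λ full →
    word?-nothing k _ eq (trans (LP.length-reverse (Vec≤.toList bs)) (trans (length-toList≤ bs) full))

  shape-step : ∀ s b s′ → ReachableShape s → step s b ≡ just s′ → ReachableShape s′
  shape-step (prefix bs) b _ _ eq with map-push-just⁻¹ afterPrefix bs b eq
  ... | _ , refl = afterPrefix-shape _
  shape-step (middle c q) b _ (w , reach) eq with δ AH q b in δqb
  ... | just q′ with refl ← eq = w ++ b ∷ [] , extended
    where
      open ≡-Reasoning
      extended : run AH (q₀ AH) (w ++ b ∷ []) ≡ just q′
      extended = begin
        run AH (q₀ AH) (w ++ b ∷ [])         ≡⟨ run≡runWith AH (q₀ AH) (w ++ b ∷ []) ⟩
        runWith (δ AH) (q₀ AH) (w ++ b ∷ []) ≡⟨ runWith-++-just (δ AH) w (b ∷ [])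
                                                  (run⇒runWith AH w reach) ⟩
        runWith (δ AH) q (b ∷ [])            ≡⟨ runWith-step (δ AH) q b [] δqb ⟩
        just q′                               ∎
  ... | nothing with layerH q ≟ ℓH
  ...   | yes _ with map-push-just⁻¹ (suffix c (acc AH q)) Vec≤.[] b eq
  ...     | _ , refl = tt
  shape-step (suffix c f bs) b _ _ eq with map-push-just⁻¹ (suffix c f) bs b eq
  ... | _ , refl = tt

  middle-stuck : ∀ c q b → step (middle c q) b ≡ nothing →
                 δ AH q b ≡ nothing × (layerH q ≡ ℓH → k ≡ 0)
  middle-stuck c q b eq with δ AH q b
  ... | nothing with layerH q ≟ ℓH
  ...   | yes _ = refl , λ _ → sym (push-nothing⁻¹ Vec≤.[] b (map-nothing⁻¹ (push Vec≤.[] b) eq))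
  ...   | no  ¬top = refl , λ top → contradiction top ¬top

  middle-layer : ∀ c {q} → layerH q ≡ ℓH → k ≡ 0 → layer (middle c q) ≡ ℓ
  middle-layer c {q} top k≡0 = begin
    k + layerH q     ≡⟨ cong (k +_) top ⟩
    k + ℓH           ≡⟨ +-identityʳ (k + ℓH) ⟨
    k + ℓH + 0       ≡⟨ cong (k + ℓH +_) k≡0 ⟨
    k + ℓH + k       ∎
    where open ≡-Reasoning

  sink-layer : ∀ s → ReachableShape s → (∀ b → step s b ≡ nothing) → layer s ≡ ℓ
  sink-layer (prefix bs) short stuck
    with () ← trans (sym (stuck false)) (cong (Maybe.map afterPrefix) (push-room bs false short))
  sink-layer (middle c q) (w , reach) stuck =
    middle-layer c top (proj₂ (middle-stuck c q false (stuck false)) top)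
    where
      top : layerH q ≡ ℓH
      top = trans (layer-run w reach)
                  (sink-paths w q reach (proj₁ (middle-stuck c q false (stuck false)) ,
                                          proj₁ (middle-stuck c q true (stuck true))))
  sink-layer (suffix c f bs) _ stuck =
    cong (k + ℓH +_) (push-nothing⁻¹ bs false (map-nothing⁻¹ (push bs false) (stuck false)))

  hasColour-length : ∀ c w → hasColour c w ≡ true → length w ≡ k
  hasColour-length c w eq with word? k w in eq′
  ... | just _ = word?-length k w eq′

  final-last : ∀ s → final s ≡ true → layer s ≡ ℓ
  final-last (middle c q) eq with ∧-true⁻¹ (acc AH q) _ eq
  ... | accepted , coloured = middle-layer c (acc-last q accepted) (sym (hasColour-length c [] coloured))
  final-last (suffix c f bs) eq = cong (k + ℓH +_)
    (trans (sym (length-toList≤ bs)) (hasColour-length c _ (proj₂ (∧-true⁻¹ f _ eq))))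

  canonical : IsCanonical M ℓ
  canonical = record
    { layer       = layer
    ; layer-bound = layer-bound
    ; layer-start = layer-afterPrefix Vec≤.[]
    ; layer-step  = layer-step
    ; sink-paths  = sink-paths′
    ; final-last  = final-last
    }
    where
      sink-paths′ : ∀ w s → runWith step start w ≡ just s →
                    (∀ b → step s b ≡ nothing) → length w ≡ ℓ
      sink-paths′ w s reach stuck = begin
        length w                 ≡⟨ cong (_+ length w) (layer-afterPrefix Vec≤.[]) ⟨
        layer start + length w   ≡⟨ runWith-layer step layer layer-step w reach ⟨
        layer s                  ≡⟨ sink-layer s shape stuck ⟩
        ℓ                        ∎
        where
          open ≡-Reasoning
          shape = runWith-invariant step ReachableShape shape-step w (afterPrefix-shape Vec≤.[]) reach

  step-middle-top : ∀ c {q} b → layerH q ≡ ℓH →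
                    step (middle c q) b ≡ Maybe.map (suffix c (acc AH q)) (push Vec≤.[] b)
  step-middle-top c {q} b top with δ AH q b | last-layer-stuck b top
  ... | nothing | refl with layerH q ≟ ℓH
  ...   | yes _   = refl
  ...   | no ¬top = contradiction top ¬top

  buffer-short : ∀ (u : Word k) (bs : Vec≤ Bool k) b r → Vec≤.toList bs ʳ++ (b ∷ r) ≡ Vec.toList u →
                 Vec≤.length bs < k
  buffer-short u bs b r eq = begin-strict
    Vec≤.length bs                           <⟨ m<m+n (Vec≤.length bs) z<s ⟩
    Vec≤.length bs + length (b ∷ r)           ≡⟨ cong (_+ length (b ∷ r)) (length-toList≤ bs) ⟨
    length (Vec≤.toList bs) + length (b ∷ r)  ≡⟨ LP.length-ʳ++ (Vec≤.toList bs) ⟨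
    length (Vec≤.toList bs ʳ++ (b ∷ r))       ≡⟨ cong length eq ⟩
    length (Vec.toList u)                     ≡⟨ VP.length-toList u ⟩
    k                                         ∎
    where open ≤-Reasoning

  run-prefix : ∀ (u : Word k) bs r → Vec≤.toList bs ʳ++ r ≡ Vec.toList u →
               runWith step (afterPrefix bs) r ≡ just (middle (col u) (q₀ AH))
  run-prefix u bs []      eq = cong just (afterPrefix-complete bs u eq)
  run-prefix u bs (b ∷ r) eq = begin
    runWith step (afterPrefix bs) (b ∷ r)                 ≡⟨ cong (λ s → runWith step s (b ∷ r))
                                                                  (afterPrefix-partial bs short) ⟩
    runWith step (prefix bs) (b ∷ r)                      ≡⟨ runWith-step step (prefix bs) b r pushed ⟩
    runWith step (afterPrefix (Vec≤._,_ (b ∷ Vec≤.vec bs) short)) r ≡⟨ run-prefix u _ r eq ⟩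
    just (middle (col u) (q₀ AH))                         ∎
    where
      open ≡-Reasoning
      short = buffer-short u bs b r eq
      pushed = cong (Maybe.map afterPrefix) (push-room bs b short)

  run-middle : ∀ c {q q′} w → runWith (δ AH) q w ≡ just q′ →
               runWith step (middle c q) w ≡ just (middle c q′)
  run-middle c []          refl = refl
  run-middle c {q} (b ∷ w) eq with δ AH q b
  ... | just q″ = run-middle c w eq

  run-middle-nothing : ∀ c {q} w → layerH q + length w ≤ ℓH →
                       runWith (δ AH) q w ≡ nothing → runWith step (middle c q) w ≡ nothing
  run-middle-nothing c {q} (b ∷ w) fits eq with δ AH q b in δqb
  ... | just q″ = run-middle-nothing c w fits′ eq
    where
      fits′ : layerH q″ + length w ≤ ℓH
      fits′ = subst (_≤ ℓH) (trans (+-suc (layerH q) (length w))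
                                   (cong (_+ length w) (sym (layerH-step q b q″ δqb)))) fits
  ... | nothing with layerH q ≟ ℓH
  ...   | yes top = contradiction (subst (λ i → i + length (b ∷ w) ≤ ℓH) top fits) (m+1+n≰m ℓH)
  ...   | no  _   = refl

  run-suffix : ∀ c f bs r → Vec≤.length bs + length r ≡ k →
               Σ (Vec≤ Bool k) λ bs′ → runWith step (suffix c f bs) r ≡ just (suffix c f bs′) ×
                                       Vec≤.toList bs′ ≡ r ʳ++ Vec≤.toList bs
  run-suffix c f bs []      _   = bs , refl , refl
  run-suffix c f bs (b ∷ r) len =
    let bs′ , reach , toList-bs′ = run-suffix c f (Vec≤._,_ (b ∷ Vec≤.vec bs) room) r
                                              (trans (sym (+-suc _ (length r))) len)
    in bs′ , trans (runWith-step step (suffix c f bs) b r pushed) reach , toList-bs′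
    where
      room : Vec≤.length bs < k
      room = subst (Vec≤.length bs <_) len (m<m+n (Vec≤.length bs) z<s)
      pushed = cong (Maybe.map (suffix c f)) (push-room bs b room)

  run-to-final : ∀ c {q} → layerH q ≡ ℓH → ∀ r → length r ≡ k →
                 Σ State λ s → runWith step (middle c q) r ≡ just s ×
                               final s ≡ acc AH q ∧ hasColour c (reverse r)
  run-to-final c top []      _   = middle c _ , refl , refl
  run-to-final c {q} top (b ∷ r) len =
    let bs′ , reach , toList-bs′ = run-suffix c (acc AH q) (Vec≤._,_ (b ∷ []) room) r len
    in suffix c (acc AH q) bs′ ,
       trans (runWith-step step (middle c q) b r (trans (step-middle-top c b top) pushed)) reach ,
       cong (λ w → acc AH q ∧ hasColour c w) toList-bs′
    where
      room : 0 < k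
      room = subst (0 <_) len z<s
      pushed = cong (Maybe.map (suffix c (acc AH q))) (push-room Vec≤.[] b room)

  hasColour-toList : ∀ c (v : Word k) → hasColour c (Vec.toList v) ≡ does (col v Fin.≟ c)
  hasColour-toList c v = cong (Maybe.maybe′ (λ v → does (col v Fin.≟ c)) false) (word?-toList v)

  module _ {m} (ℓH≡ : ℓH ≡ m + suc m) (x y : Word (k + m)) where
    private
      u = Vec.take k x
      v = Vec.take k y
      a = Vec.drop k x
      b = Vec.drop k y
      same-colour? = col v Fin.≟ col u

    run-sample-prefix : runWith step start (sampleWord x y) ≡
                        runWith step (middle (col u) (q₀ AH)) (sampleWord a b ++ reverse (Vec.toList v))
    run-sample-prefix = trans (cong (runWith step start) (sampleWord-take-drop k x y))
                              (runWith-++-just step (Vec.toList u) _ (run-prefix u Vec≤.[] (Vec.toList u) refl))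

    run-sample-accepted : ∀ {q} → run AH (q₀ AH) (sampleWord a b) ≡ just q →
                          Σ State λ s → runWith step start (sampleWord x y) ≡ just s ×
                                        final s ≡ acc AH q ∧ does same-colour?
    run-sample-accepted {q} reach =
      let s , reach′ , final-s = run-to-final (col u) top (reverse (Vec.toList v)) length-v
      in s , trans run-sample-prefix (trans through-H reach′) , trans final-s colour-test
      where
        top : layerH q ≡ ℓH
        top = trans (layer-run (sampleWord a b) reach) (trans (length-sampleWord a b) (sym ℓH≡))

        length-v : length (reverse (Vec.toList v)) ≡ k
        length-v = trans (LP.length-reverse (Vec.toList v)) (VP.length-toList v)

        through-H : runWith step (middle (col u) (q₀ AH)) (sampleWord a b ++ reverse (Vec.toList v)) ≡
                    runWith step (middle (col u) q) (reverse (Vec.toList v))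
        through-H = runWith-++-just step (sampleWord a b) _
                      (run-middle (col u) (sampleWord a b) (run⇒runWith AH (sampleWord a b) reach))

        colour-test : acc AH q ∧ hasColour (col u) (reverse (reverse (Vec.toList v))) ≡
                      acc AH q ∧ does same-colour?
        colour-test = cong (acc AH q ∧_) (trans (cong (hasColour (col u)) (LP.reverse-involutive (Vec.toList v)))
                                                (hasColour-toList (col u) v))

    run-sample-rejected : run AH (q₀ AH) (sampleWord a b) ≡ nothing →
                          runWith step start (sampleWord x y) ≡ nothing
    run-sample-rejected dies = trans run-sample-prefix (runWith-++-nothing step (sampleWord a b) _
      (run-middle-nothing (col u) (sampleWord a b) fits (run⇒runWith AH (sampleWord a b) dies)))
      where
        fits : layerH (q₀ AH) + length (sampleWord a b) ≤ ℓH
        fits = ≤-reflexive (trans (cong (_+ length (sampleWord a b)) layer-q₀)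
                                  (trans (length-sampleWord a b) (sym ℓH≡)))

    accepts-sample⁻¹ : Accepts AH (sampleWord a b) → col v ≡ col u → AcceptsM M (sampleWord x y)
    accepts-sample⁻¹ (q , reach , accepted) same-colour =
      let s , reach′ , final-s = run-sample-accepted reach
      in s , reach′ , trans final-s (cong₂ _∧_ accepted (dec-true same-colour? same-colour))

    accepts-sample : AcceptsM M (sampleWord x y) → Accepts AH (sampleWord a b) × col v ≡ col u
    accepts-sample (s , reach , final-s) with run AH (q₀ AH) (sampleWord a b) in runH
    ... | nothing with () ← trans (sym reach) (run-sample-rejected runH)
    ... | just q with run-sample-accepted runH
    ...   | _ , reach′ , final-s′ with refl ← trans (sym reach) reach′ =
      let accepted , coloured = ∧-true⁻¹ (acc AH q) (does same-colour?) (trans (sym final-s′) final-s)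
      in (q , refl , accepted) , does-true⁻¹ same-colour? coloured

  consistent : ∀ {m} (G : Graph k) (H : Graph m) → ProperColouring G χ col → Consistent AH R[ H ] →
               ConsistentM M R[ G · H ]
  consistent {m} G H proper (posH , negH) = positive , negative
    where
      a₀ : Word m
      a₀ = Vec.replicate m false

      ℓH≡ : ℓH ≡ m + suc m
      ℓH≡ = trans (sym (accepted-length (sampleWord a₀ a₀) (posH _ (a₀ , refl))))
                  (length-sampleWord a₀ a₀)

      positive : ∀ w → Pos R[ G · H ] w → AcceptsM M w
      positive _ (x , refl) = accepts-sample⁻¹ ℓH≡ x x (posH _ (Vec.drop k x , refl)) refl

      negative : ∀ w → Neg R[ G · H ] w → ¬ AcceptsM M w
      negative _ (x , y , adj , refl) accepted with accepts-sample ℓH≡ x y accepted | adj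
      ... | _         , same-colour | inj₁ edgeG       = proper _ _ edgeG (sym same-colour)
      ... | acceptedH , _           | inj₂ (_ , edgeH) = negH _ (_ , _ , edgeH , refl) acceptedH

  #states : ℕ
  #states = χ * nH + (χ * (2 * #bitStrings≤ k) + #bitStrings≤ k)

  State↪Fin : State ↪ Fin #states
  State↪Fin = ⊎↪+ (↔⇒↪ (↔-sym *↔×))
              (⊎↪+ (×↪* (↪-id (Fin χ)) (×↪* (↔⇒↪ (↔-sym 2↔Bool)) (bitStrings≤↪Fin k)))
                   (bitStrings≤↪Fin k))

  solves : ∀ {m} (G : Graph k) (H : Graph m) → ProperColouring G χ col → Consistent AH R[ H ] →
           Solves R[ G · H ] #states
  solves G H proper consH = toDFA-solves M State↪Fin canonical (consistent G H proper consH)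

#states-bound : ∀ χ nH k .{{_ : NonZero χ}} →
                χ * nH + (χ * (2 * #bitStrings≤ k) + #bitStrings≤ k) ≤ χ * (nH + 6 * 2 ^ k)
#states-bound χ nH k = begin
  χ * nH + (χ * (2 * N) + N)
    ≤⟨ +-monoʳ-≤ (χ * nH) (+-mono-≤ (*-monoʳ-≤ χ (*-monoʳ-≤ 2 N≤2p)) N≤χ2p) ⟩
  χ * nH + (χ * (2 * (2 * p)) + χ * (2 * p))
    ≡⟨ regroup χ nH p ⟩
  χ * (nH + 6 * p)
    ∎
  where
    open ≤-Reasoning
    N = #bitStrings≤ k
    p = 2 ^ k
    N≤2p : N ≤ 2 * p
    N≤2p = ≤-trans (n≤1+n N) (≤-reflexive (suc-#bitStrings≤ k))
    N≤χ2p : N ≤ χ * (2 * p)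
    N≤χ2p = ≤-trans N≤2p (m≤n*m (2 * p) χ)
    regroup : ∀ a b c → a * b + (a * (2 * (2 * c)) + a * (2 * c)) ≡ a * (b + 6 * c)
    regroup = solve 3 (λ a b c → a :* b :+ (a :* (con 2 :* (con 2 :* c)) :+ a :* (con 2 :* c))
                                 := a :* (b :+ con 6 :* c)) refl
      where open +-*-Solver

lemma5p4 : Σ ℕ λ C → C > 0 ×
    (∀ {k m} (G : Graph k) (H : Graph m) (χG optGH optH : ℕ) →
      IsChromaticNumber G χG →
      IsOpt R[ G · H ] optGH →
      IsOpt R[ H ] optH →
      optGH ≤ χG * (optH + C * ∣V∣ G))
lemma5p4 = 6 , z<s , bound
  where
    bound : ∀ {k m} (G : Graph k) (H : Graph m) (χG optGH optH : ℕ) →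
            IsChromaticNumber G χG → IsOpt R[ G · H ] optGH → IsOpt R[ H ] optH →
            optGH ≤ χG * (optH + 6 * ∣V∣ G)
    bound {k} G H χG optGH optH ((col , proper) , _) (_ , optimal) ((AH , (_ , CH) , consH) , _) = begin
      optGH                              ≤⟨ optimal _ (Construction.solves col AH CH G H proper consH) ⟩
      Construction.#states {k} col AH CH ≤⟨ #states-bound χG optH k {{χG≢0}} ⟩
      χG * (optH + 6 * ∣V∣ G)            ∎
      where
        open ≤-Reasoning
        χG≢0 = nonZeroIndex (col (Vec.replicate k false))
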